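{- Let $\mathbb{F}$ be a field, $d \ge 2$, $n \ge 1$, and let $T \in \mathsf{T}^d(n)$ satisfy $\mathrm{oprank}(T) < n$. Then $\det(T) = 0$. Equivalently, if $\det(T) \neq 0$ then $\mathrm{oprank}(T) = n$; in particular $\mathrm{rank}(T) \ge n$, and if $d$ is even then $\mathrm{srank}(T) = n$.
   Context: $\mathsf{T}^d(n)$ denotes the set of functions $T:[n]^d \to \mathbb{F}$ ($d$-tensors), $[n]=\{1,\dots,n\}$. The hyperdeterminant of $T\in\mathsf{T}^d(n)$ is $\det(T) = \sum_{\sigma_2,\dots,\sigma_d \in S_n} \mathrm{sgn}(\sigma_2\cdots\sigma_d)\prod_{i=1}^n T(i,\sigma_2(i),\dots,\sigma_d(i))$ (defined for all $d$, odd or even). For a set $\mathsf{S}\subset\mathsf{T}^d(n)$ of "simple" tensors, $\mathrm{rank}_{\mathsf{S}}(T)$ is the minimal $r$ such that $T=\sum_{\ell=1}^r T_\ell$ with all $T_\ell\in\mathsf{S}$ ($\mathrm{rank}_{\mathsf S}(T)=0$ iff $T=0$). Tensor rank $\mathrm{rank}$: simple tensors are $T(i_1,\dots,i_d)=\mathbf v_1(i_1)\cdots\mathbf v_d(i_d)$ with nonzero $\mathbf v_j\in\mathbb F^n$. Slice rank $\mathrm{srank}$: simple tensors are $T(i_1,\dots,i_d)=\mathbf v(i_k)\,T_1(i_1,\dots,i_{k-1},i_{k+1},\dots,i_d)$ for some $k\in[d]$, nonzero $\mathbf v\in\mathbb F^n$ and $T_1\in\mathsf T^{d-1}(n)$.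 Odd partition rank $\mathrm{oprank}$: simple tensors are $T(i_1,\dots,i_d)=T_1(i_{a_1},\dots,i_{a_k})\,T_2(i_{b_1},\dots,i_{b_{d-k}})$ for a partition $\{a_1<\dots<a_k\}\cup\{b_1<\dots<b_{d-k}\}=[d]$ into two nonempty blocks and nonzero $T_1\in\mathsf T^k(n)$, $T_2\in\mathsf T^{d-k}(n)$, where one of the two blocks has odd size and does not contain the element $1$ (the partition may differ between simple tensors). -}

module Defs where

open import Level using (Level; _⊔_)
open import Algebra.Bundles using (CommutativeRing)
open import Data.Nat as ℕ using (ℕ; zero; suc; _<_; _%_)
open import Data.Bool using (Bool; true; false; not)
open import Data.Fin using (Fin; zero; suc)
open import Data.Vec using (Vec; []; _∷_; lookup; tabulate; map; foldr)
open import Data.Vec.Relation.Unary.All using (All)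
open import Data.List as List using (List; []; _∷_; concatMap; _++_)
open import Data.Product using (Σ; _×_; _,_; ∃)
open import Data.Sum using (_⊎_)
open import Relation.Nullary using (¬_)
open import Relation.Binary.PropositionalEquality using (_≡_)
import Data.Empty.Polymorphic
import Data.Unit
import Data.Fin
import Data.Vec
import Relation.Nullary
open import Data.Nat.ListAction using () renaming (sum to sumℕ)

record Field (c ℓ : Level) : Set (Level.suc (c ⊔ ℓ)) where
  field
    commRing : CommutativeRing c ℓ
  open CommutativeRing commRing public
  field
    0≉1     : ¬ (0# ≈ 1#)
    inverse : ∀ x → ¬ (x ≈ 0#) → Σ Carrier λ y → x * y ≈ 1#

-- Subsets of [d] as characteristic vectors; `count A` = |A|.
count : ∀ {d} → Vec Bool d → ℕ
count []          = 0
count (true  ∷ A) = suc (count A)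
count (false ∷ A) = count A

select : ∀ {d} {X : Set} (A : Vec Bool d) → Vec X d → Vec X (count A)
select []          []       = []
select (true  ∷ A) (x ∷ xs) = x ∷ select A xs
select (false ∷ A) (x ∷ xs) = select A xs

complement : ∀ {d} → Vec Bool d → Vec Bool d
complement = map not

Odd : ℕ → Set
Odd m = m % 2 ≡ 1

Even : ℕ → Set
Even m = m % 2 ≡ 0

-- A permutation of [n] given as a function Fin n → Fin n.
-- `perms n` lists every permutation of [n] exactly once
-- (built by inserting the new top element into every position).
Perm : ℕ → Set
Perm n = Fin n → Fin n

insertAt : ∀ {A : Set} {n} → Fin (suc n) → A → Vec A n → Vec A (suc n)
insertAt zero    a xs       = a ∷ xs
insertAt (suc p) a (x ∷ xs) = x ∷ insertAt p a xs

permVecs : (n : ℕ) → List (Vec (Fin n) n)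
permVecs zero    = [] ∷ []
permVecs (suc n) =
  concatMap (λ v → List.map (λ p → insertAt p (Data.Fin.fromℕ n) (map Data.Fin.inject₁ v))
                            (List.allFin (suc n)))
            (permVecs n)

perms : (n : ℕ) → List (Perm n)
perms n = List.map lookup (permVecs n)

inversions : ∀ {n} → Perm n → ℕ
inversions {n} σ =
  sumℕ (List.map (λ i → sumℕ (List.map (λ j → inv i j) (List.allFin n)))
                     (List.allFin n))
  where
  inv : Fin n → Fin n → ℕ
  inv i j with Data.Fin._<?_ i j | Data.Fin._<?_ (σ j) (σ i)
  ... | Relation.Nullary.yes _ | Relation.Nullary.yes _ = 1
  ... | _ | _ = 0

permTuples : (n k : ℕ) → List (Vec (Perm n) k)
permTuples n zero    = [] ∷ []
permTuples n (suc k) = concatMap (λ σ → List.map (σ ∷_) (permTuples n k)) (perms n)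

module _ {c ℓ} (F : Field c ℓ) where
  open Field F

  Tensor : ℕ → ℕ → Set c
  Tensor d n = Vec (Fin n) d → Carrier

  Nonzero : ∀ {d n} → Tensor d n → Set ℓ
  Nonzero T = ¬ (∀ idx → T idx ≈ 0#)

  sgn : ∀ {n} → Perm n → Carrier
  sgn σ with inversions σ % 2
  ... | zero = 1#
  ... | suc _ = - 1#

  sumL : List Carrier → Carrier
  sumL = List.foldr _+_ 0#

  prodL : List Carrier → Carrier
  prodL = List.foldr _*_ 1#

  -- hyperdeterminant
  -- det T = Σ_{σ_2,…,σ_d ∈ S_n} sgn(σ_2⋯σ_d) Π_i T(i, σ_2(i), …, σ_d(i)).
  -- sgn(σ_2⋯σ_d) = Π_j sgn(σ_j) (sgn is multiplicative).
  -- For d = 0 (never used: the theorem assumes d ≥ 2) we set det T = 1#.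
  det : ∀ {d n} → Tensor d n → Carrier
  det {zero}  {n} T = 1#
  det {suc k} {n} T =
    sumL (List.map (λ σs →
            prodL (List.map sgn (Data.Vec.toList σs)) *
            prodL (List.map (λ i → T (i ∷ map (λ σ → σ i) σs)) (List.allFin n)))
          (permTuples n k))

  sumT : ∀ {d n r} → Vec (Tensor d n) r → Tensor d n
  sumT ts idx = foldr _ (λ t acc → t idx + acc) 0# ts

  HasDecomp : ∀ {d n} → (Tensor d n → Set (c ⊔ ℓ)) → Tensor d n → ℕ → Set (c ⊔ ℓ)
  HasDecomp S T r = Σ (Vec _ r) λ ts → All S ts × (∀ idx → T idx ≈ sumT ts idx)

  RankLt : ∀ {d n} → (Tensor d n → Set (c ⊔ ℓ)) → Tensor d n → ℕ → Set (c ⊔ ℓ)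
  RankLt S T m = Σ ℕ λ r → r < m × HasDecomp S T r

  RankGe : ∀ {d n} → (Tensor d n → Set (c ⊔ ℓ)) → Tensor d n → ℕ → Set (c ⊔ ℓ)
  RankGe S T m = ¬ RankLt S T m

  RankEq : ∀ {d n} → (Tensor d n → Set (c ⊔ ℓ)) → Tensor d n → ℕ → Set (c ⊔ ℓ)
  RankEq S T m = HasDecomp S T m × RankGe S T m

  RankOne : ∀ {d n} → Tensor d n → Set (c ⊔ ℓ)
  RankOne {d} {n} T =
    Σ (Vec (Fin n → Carrier) d) λ vs →
      (∀ j → ¬ (∀ i → lookup vs j i ≈ 0#)) ×
      (∀ idx → T idx ≈ foldr _ _*_ 1# (tabulate (λ j → lookup vs j (lookup idx j))))

  SliceOne : ∀ {d n} → Tensor d n → Set (c ⊔ ℓ)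
  SliceOne {zero}  {n} T = Data.Empty.Polymorphic.⊥
  SliceOne {suc d} {n} T =
    Σ (Fin (suc d)) λ k → Σ (Fin n → Carrier) λ v → Σ (Tensor d n) λ T₁ →
      (¬ (∀ i → v i ≈ 0#)) ×
      (∀ idx → T idx ≈ v (lookup idx k) * T₁ (Data.Vec.removeAt idx k))

  OddPartOne : ∀ {d n} → Tensor d n → Set (c ⊔ ℓ)
  OddPartOne {d} {n} T =
    Σ (Vec Bool d) λ A →
    Σ (Tensor (count A) n) λ T₁ → Σ (Tensor (count (complement A)) n) λ T₂ →
      (0 < count A) × (0 < count (complement A)) ×
      (Block A ⊎ Block (complement A)) ×
      Nonzero T₁ × Nonzero T₂ ×
      (∀ idx → T idx ≈ T₁ (select A idx) * T₂ (select (complement A) idx))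
    where
    -- block X has odd size and does not contain the element 1
    -- (for d = 0 there is no element 1; blocks are then empty anyway)
    NotFirst : Vec Bool d → Set
    NotFirst [] = Data.Unit.⊤
    NotFirst (b ∷ _) = b ≡ false

    Block : Vec Bool d → Set
    Block X = Odd (count X) × NotFirst X

{-# OPTIONS --safe #-}
module Submission where

-- Expand det T multilinearly along T = S₁ + ⋯ + S_r with r < n: by pigeonhole, each resulting
-- term takes two of its n factors, say those at i ≠ j, from the same simple tensor S. Apart from
-- the first index, S is a function of an odd block B of coordinates times a function of the
-- others, so composing the permutations indexed by B with the transposition (i j) keeps the
-- product of the term but flips its sign (|B| is odd, and a transposition changes the parity of
-- the number of inversions): the terms cancel in pairs. If det T ≠ 0, the n slices of T along the
-- second index are simple for odd partition rank and for slice rank, so both ranks equal n.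

open import Defs
open import Level using (_⊔_)
open import Algebra.Bundles using (CommutativeMonoid; CommutativeSemiring; CommutativeRing)
open import Data.Bool using (Bool; true; false; not; _∧_; _xor_; if_then_else_)
import Data.Bool.Properties as Boolₚ
open import Data.Nat as ℕ using (ℕ; zero; suc; _≤_; z≤n; s≤s)
import Data.Nat.Properties as ℕₚ
open import Data.Fin using (Fin; zero; suc; punchIn; punchOut; fromℕ; inject₁; lower₁; toℕ; _≟_; _<?_)
import Data.Fin.Properties as Finₚ
open import Data.Fin.Permutation.Components using (transpose)
open import Data.Vec as Vec using (Vec; []; _∷_; lookup; tabulate; removeAt; replicate)
import Data.Vec.Properties as Vecₚ
import Data.Vec.Relation.Unary.All as VecAll
open import Data.Vec.Functional using (Vector)
open import Data.List as List using (List; []; _∷_; _++_; concatMap; allFin; filter; length)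
import Data.List.Properties as Listₚ
open import Data.List.Membership.Propositional using (_∈_)
open import Data.List.Membership.Propositional.Properties
  using (∈-allFin; ∈-filter⁺; ∈-filter⁻; ∈-cartesianProductWith⁺; ∈-cartesianProductWith⁻)
open import Data.List.Relation.Binary.Subset.Propositional using (_⊆_)
open import Data.List.Relation.Unary.All as ListAll using ()
open import Data.List.Relation.Unary.Any using (here; there)
open import Data.List.Relation.Unary.AllPairs using ([]; _∷_)
open import Data.List.Relation.Unary.Unique.Propositional using (Unique)
import Data.List.Relation.Unary.Unique.Propositional.Properties as Uniqueₚ
open import Data.Product using (Σ; ∃; _×_; _,_; proj₁; proj₂)
open import Data.Sum using (inj₁; inj₂)
open import Data.Nat.ListAction using () renaming (sum to sumℕ)
open import Function using (_∘_; id)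
open import Function.Definitions using (Injective)
open import Relation.Nullary using (¬_; Dec; yes; no; does)
open import Relation.Nullary.Decidable using (dec-true; dec-false; ¬?)
open import Relation.Nullary.Negation using (contradiction)
open import Relation.Binary.Definitions using (DecidableEquality; tri<; tri≈; tri>)
open import Relation.Binary.PropositionalEquality as ≡
  using (_≡_; _≢_; cong; cong₂; subst)

module Sums {a ℓ} (M : CommutativeMonoid a ℓ) where
  open CommutativeMonoid M
  open import Algebra.Properties.CommutativeMonoid.Sum M public
  open import Algebra.Properties.CommutativeSemigroup commutativeSemigroup
    using (interchange; x∙yz≈y∙xz)
  open import Relation.Binary.Reasoning.Setoid setoid

  private variable A B : Set

  sum-zero : ∀ {n} {f : Vector Carrier n} → (∀ a → f a ≈ ε) → sum f ≈ ε
  sum-zero {n} f≈ε = trans (sum-cong-≋ f≈ε) (sum-replicate-zero n)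

  sum-single : ∀ {n} {f : Vector Carrier n} i → (∀ a → a ≢ i → f a ≈ ε) → sum f ≈ f i
  sum-single {suc n} {f} i off = begin
    sum f                     ≈⟨ sum-remove {i = i} f ⟩
    f i ∙ sum (f ∘ punchIn i) ≈⟨ ∙-congˡ (sum-zero λ k → off _ (Finₚ.punchInᵢ≢i i k)) ⟩
    f i ∙ ε                   ≈⟨ identityʳ _ ⟩
    f i                       ∎

  others : ∀ {n} {i j : Fin (suc (suc n))} → i ≢ j → Fin n → Fin (suc (suc n))
  others {i = i} i≢j k = punchIn i (punchIn (punchOut i≢j) k)

  others≢ˡ : ∀ {n} {i j : Fin (suc (suc n))} (i≢j : i ≢ j) k → others i≢j k ≢ i
  others≢ˡ {i = i} i≢j k = Finₚ.punchInᵢ≢i i _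

  others≢ʳ : ∀ {n} {i j : Fin (suc (suc n))} (i≢j : i ≢ j) k → others i≢j k ≢ j
  others≢ʳ {i = i} i≢j k eq = Finₚ.punchInᵢ≢i (punchOut i≢j) k
    (Finₚ.punchIn-injective i _ _ (≡.trans eq (≡.sym (Finₚ.punchIn-punchOut i≢j))))

  sum-remove₂ : ∀ {n} {i j : Fin (suc (suc n))} (i≢j : i ≢ j) (f : Vector Carrier (suc (suc n))) →
                sum f ≈ (f i ∙ f j) ∙ sum (f ∘ others i≢j)
  sum-remove₂ {i = i} {j} i≢j f = begin
    sum f                                        ≈⟨ sum-remove {i = i} f ⟩
    f i ∙ sum (f ∘ punchIn i)                    ≈⟨ ∙-congˡ (sum-remove {i = punchOut i≢j} (f ∘ punchIn i)) ⟩
    f i ∙ (f (punchIn i (punchOut i≢j)) ∙ rest)  ≡⟨ cong (λ x → f i ∙ (f x ∙ rest)) (Finₚ.punchIn-punchOut i≢j) ⟩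
    f i ∙ (f j ∙ rest)                           ≈⟨ sym (assoc _ _ _) ⟩
    (f i ∙ f j) ∙ rest                           ∎
    where rest = sum (f ∘ others i≢j)

  sum-pair : ∀ {n} {f : Vector Carrier n} {i j} → i ≢ j →
             (∀ a → a ≢ i → a ≢ j → f a ≈ ε) → sum f ≈ f i ∙ f j
  sum-pair {suc zero} {i = zero} {zero} i≢j _ = contradiction ≡.refl i≢j
  sum-pair {suc (suc n)} {f} {i} {j} i≢j off = begin
    sum f                              ≈⟨ sum-remove₂ i≢j f ⟩
    (f i ∙ f j) ∙ sum (f ∘ others i≢j) ≈⟨ ∙-congˡ (sum-zero λ k → off _ (others≢ˡ i≢j k) (others≢ʳ i≢j k)) ⟩
    (f i ∙ f j) ∙ ε                    ≈⟨ identityʳ _ ⟩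
    f i ∙ f j                          ∎

  sum-cong-off₂ : ∀ {n} {f g : Vector Carrier n} {i j} → i ≢ j →
                  (∀ a → a ≢ i → a ≢ j → f a ≈ g a) → f i ∙ f j ≈ g i ∙ g j → sum f ≈ sum g
  sum-cong-off₂ {suc zero} {i = zero} {zero} i≢j _ _ = contradiction ≡.refl i≢j
  sum-cong-off₂ {suc (suc n)} {f} {g} {i} {j} i≢j off pair = begin
    sum f                              ≈⟨ sum-remove₂ i≢j f ⟩
    (f i ∙ f j) ∙ sum (f ∘ others i≢j) ≈⟨ ∙-cong pair (sum-cong-≋ λ k → off _ (others≢ˡ i≢j k) (others≢ʳ i≢j k)) ⟩
    (g i ∙ g j) ∙ sum (g ∘ others i≢j) ≈⟨ sym (sum-remove₂ i≢j g) ⟩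
    sum g                              ∎

  ∑L : ∀ {A : Set} → (A → Carrier) → List A → Carrier
  ∑L f xs = List.foldr _∙_ ε (List.map f xs)

  ∑L-allFin : ∀ {n} (f : Fin n → Carrier) → ∑L f (allFin n) ≡ sum f
  ∑L-allFin f = ≡.trans (cong (List.foldr _∙_ ε) (Listₚ.map-tabulate id f)) (foldr-tabulate f)
    where
    foldr-tabulate : ∀ {n} (g : Fin n → Carrier) → List.foldr _∙_ ε (List.tabulate g) ≡ sum g
    foldr-tabulate {zero}  g = ≡.refl
    foldr-tabulate {suc n} g = cong (g zero ∙_) (foldr-tabulate (g ∘ suc))

  ∑L-cong : ∀ {f g : A → Carrier} {xs} → (∀ {x} → x ∈ xs → f x ≈ g x) → ∑L f xs ≈ ∑L g xs
  ∑L-cong {xs = []}     _   = refl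
  ∑L-cong {xs = x ∷ xs} f≈g = ∙-cong (f≈g (here ≡.refl)) (∑L-cong (f≈g ∘ there))

  ∑L-zero : ∀ {f : A → Carrier} {xs} → (∀ {x} → x ∈ xs → f x ≈ ε) → ∑L f xs ≈ ε
  ∑L-zero {xs = []}     _   = refl
  ∑L-zero {xs = x ∷ xs} f≈ε = trans (∙-cong (f≈ε (here ≡.refl)) (∑L-zero (f≈ε ∘ there))) (identityˡ ε)

  ∑L-map : ∀ {f : B → Carrier} (h : A → B) xs → ∑L f (List.map h xs) ≡ ∑L (f ∘ h) xs
  ∑L-map h xs = cong (List.foldr _∙_ ε) (≡.sym (Listₚ.map-∘ xs))

  ∑L-++ : ∀ {f : B → Carrier} xs {ys} → ∑L f (xs ++ ys) ≈ ∑L f xs ∙ ∑L f ys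
  ∑L-++ []       = sym (identityˡ _)
  ∑L-++ (x ∷ xs) = trans (∙-congˡ (∑L-++ xs)) (sym (assoc _ _ _))

  ∑L-concatMap : ∀ {f : B → Carrier} (h : A → List B) xs →
                 ∑L f (concatMap h xs) ≈ ∑L (λ x → ∑L f (h x)) xs
  ∑L-concatMap h []       = refl
  ∑L-concatMap h (x ∷ xs) = trans (∑L-++ (h x)) (∙-congˡ (∑L-concatMap h xs))

  ∑L-distrib : ∀ (f g : A → Carrier) xs → ∑L (λ x → f x ∙ g x) xs ≈ ∑L f xs ∙ ∑L g xs
  ∑L-distrib f g []       = sym (identityˡ ε)
  ∑L-distrib f g (x ∷ xs) = trans (∙-congˡ (∑L-distrib f g xs)) (interchange _ _ _ _)

  ∑L-comm : ∀ (f : A → B → Carrier) xs ys →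
            ∑L (λ x → ∑L (f x) ys) xs ≈ ∑L (λ y → ∑L (λ x → f x y) xs) ys
  ∑L-comm f []       ys = sym (∑L-zero {xs = ys} λ _ → refl)
  ∑L-comm f (x ∷ xs) ys = trans (∙-congˡ (∑L-comm f xs ys)) (sym (∑L-distrib _ _ ys))

  module _ (_≟ᴬ_ : DecidableEquality A) where

    without : A → List A → List A
    without y = filter (λ x → ¬? (x ≟ᴬ y))

    ∑L-without : ∀ {f : A → Carrier} {y xs} → Unique xs → y ∈ xs →
                 ∑L f xs ≈ f y ∙ ∑L f (without y xs)
    ∑L-without {f} {xs = x ∷ xs} (x∉xs ∷ _) (here ≡.refl) = ∙-congˡ (reflexive (cong (∑L f) (≡.sym drop-x)))
      where
      drop-x : without x (x ∷ xs) ≡ xs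
      drop-x = ≡.trans (Listₚ.filter-reject (λ x → ¬? (x ≟ᴬ _)) (λ x≢x → x≢x ≡.refl))
                     (Listₚ.filter-all (λ x → ¬? (x ≟ᴬ _)) (ListAll.map (λ x≢z z≡x → x≢z (≡.sym z≡x)) x∉xs))
    ∑L-without {f} {y} {x ∷ xs} (x∉xs ∷ u) (there y∈xs) = begin
      f x ∙ ∑L f xs                     ≈⟨ ∙-congˡ (∑L-without u y∈xs) ⟩
      f x ∙ (f y ∙ ∑L f (without y xs)) ≈⟨ x∙yz≈y∙xz _ _ _ ⟩
      f y ∙ (f x ∙ ∑L f (without y xs)) ≡⟨ cong (λ zs → f y ∙ ∑L f zs) keep-x ⟨
      f y ∙ ∑L f (without y (x ∷ xs))   ∎
      where
      keep-x : without y (x ∷ xs) ≡ x ∷ without y xs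
      keep-x = Listₚ.filter-accept (λ x → ¬? (x ≟ᴬ y)) (ListAll.lookup x∉xs y∈xs)

    ∑L-cancel : ∀ {f : A → Carrier} (φ : A → A) {xs} → Unique xs →
                (∀ {x} → x ∈ xs → φ x ∈ xs) → (∀ {x} → x ∈ xs → φ (φ x) ≡ x) →
                (∀ {x} → x ∈ xs → φ x ≢ x) → (∀ {x} → x ∈ xs → f x ∙ f (φ x) ≈ ε) →
                ∑L f xs ≈ ε
    ∑L-cancel {f} φ {xs} xs-unique xs-closed involutive fixed-point-free orbit≈ε =
      go (length xs) ℕₚ.≤-refl id xs-unique xs-closed
      where
      ∈-tail : ∀ {y x ys} → y ∈ x ∷ ys → y ≢ x → y ∈ ys
      ∈-tail (here y≡x)  y≢x = contradiction y≡x y≢x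
      ∈-tail (there y∈ys) _  = y∈ys

      go : ∀ m {ys} → length ys ≤ m → ys ⊆ xs → Unique ys → (∀ {y} → y ∈ ys → φ y ∈ ys) → ∑L f ys ≈ ε
      go _       {[]}     _         _   _            _      = refl
      go (suc m) {x ∷ ys} (s≤s len) sub (x∉ys ∷ u) closed = begin
        f x ∙ ∑L f ys                  ≈⟨ ∙-congˡ (∑L-without u φx∈ys) ⟩
        f x ∙ (f (φ x) ∙ ∑L f zs)      ≈⟨ sym (assoc _ _ _) ⟩
        (f x ∙ f (φ x)) ∙ ∑L f zs      ≈⟨ ∙-congʳ (orbit≈ε x∈xs) ⟩
        ε ∙ ∑L f zs                    ≈⟨ identityˡ _ ⟩
        ∑L f zs                        ≈⟨ go m (ℕₚ.≤-trans (Listₚ.length-filter _ ys) len) zs⊆xs zs-unique zs-closed ⟩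
        ε                              ∎
        where
        x∈xs = sub (here ≡.refl)
        φx∈ys = ∈-tail (closed (here ≡.refl)) (fixed-point-free x∈xs)
        zs = without (φ x) ys
        zs⊆ys : zs ⊆ ys
        zs⊆ys = proj₁ ∘ ∈-filter⁻ (λ z → ¬? (z ≟ᴬ φ x)) {xs = ys}
        zs⊆xs : zs ⊆ xs
        zs⊆xs = sub ∘ there ∘ zs⊆ys
        zs-unique : Unique zs
        zs-unique = Uniqueₚ.filter⁺ (λ z → ¬? (z ≟ᴬ φ x)) u
        zs-closed : ∀ {z} → z ∈ zs → φ z ∈ zs
        zs-closed {z} z∈zs = ∈-filter⁺ (λ z → ¬? (z ≟ᴬ φ x)) (∈-tail (closed (there z∈ys)) φz≢x) φz≢φx
          where
          z∈ys = zs⊆ys z∈zs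
          z≡φφz = ≡.sym (involutive (zs⊆xs z∈zs))
          φz≢x : φ z ≢ x
          φz≢x φz≡x = proj₂ (∈-filter⁻ (λ z → ¬? (z ≟ᴬ φ x)) {xs = ys} z∈zs) (≡.trans z≡φφz (cong φ φz≡x))
          φz≢φx : φ z ≢ φ x
          φz≢φx φz≡φx = ListAll.lookup x∉ys z∈ys
            (≡.sym (≡.trans z≡φφz (≡.trans (cong φ φz≡φx) (involutive x∈xs))))

module Tuples where
  open ≡ using (refl; sym; trans)

  private variable A B C : Set

  concatMap≡cartesianProductWith : ∀ (f : A → B → C) xs ys →
    concatMap (λ x → List.map (f x) ys) xs ≡ List.cartesianProductWith f xs ys
  concatMap≡cartesianProductWith f []       ys = refl
  concatMap≡cartesianProductWith f (x ∷ xs) ys = cong (List.map (f x) ys ++_) (concatMap≡cartesianProductWith f xs ys)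

  tuples : List A → (k : ℕ) → List (Vec A k)
  tuples xs zero    = [] ∷ []
  tuples xs (suc k) = concatMap (λ x → List.map (x ∷_) (tuples xs k)) xs

  tuples-suc : ∀ (xs : List A) k → tuples xs (suc k) ≡ List.cartesianProductWith _∷_ xs (tuples xs k)
  tuples-suc xs k = concatMap≡cartesianProductWith _∷_ xs (tuples xs k)

  ∈-tuples⁺ : ∀ {xs : List A} {k} {vs : Vec A k} → VecAll.All (_∈ xs) vs → vs ∈ tuples xs k
  ∈-tuples⁺ VecAll.[]              = here refl
  ∈-tuples⁺ {xs = xs} (x∈xs VecAll.∷ vs∈) =
    subst (_ ∈_) (sym (tuples-suc xs _)) (∈-cartesianProductWith⁺ _∷_ x∈xs (∈-tuples⁺ vs∈))

  ∈-tuples⁻ : ∀ {xs : List A} {k} {vs : Vec A k} → vs ∈ tuples xs k → VecAll.All (_∈ xs) vs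
  ∈-tuples⁻ {k = zero}  {[]} _ = VecAll.[]
  ∈-tuples⁻ {xs = xs} {suc k} vs∈
    with x , ws , x∈xs , ws∈ , refl ← ∈-cartesianProductWith⁻ _∷_ xs (tuples xs k) (subst (_ ∈_) (tuples-suc xs k) vs∈)
    = x∈xs VecAll.∷ ∈-tuples⁻ ws∈

  tuples-unique : ∀ {xs : List A} {k} → Unique xs → Unique (tuples xs k)
  tuples-unique {k = zero}  _ = ListAll.[] ∷ []
  tuples-unique {xs = xs} {suc k} u =
    subst Unique (sym (tuples-suc xs k)) (Uniqueₚ.cartesianProductWith⁺ _∷_ Vecₚ.∷-injective u (tuples-unique u))

  tuples-map : ∀ (h : A → B) xs k → tuples (List.map h xs) k ≡ List.map (Vec.map h) (tuples xs k)
  tuples-map h xs zero    = refl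
  tuples-map h xs (suc k) = begin
    concatMap (λ y → List.map (y ∷_) (tuples (List.map h xs) k)) (List.map h xs)
      ≡⟨ cong (λ T → concatMap (λ y → List.map (y ∷_) T) (List.map h xs)) (tuples-map h xs k) ⟩
    concatMap (λ y → List.map (y ∷_) T) (List.map h xs)
      ≡⟨ Listₚ.concatMap-map _ h xs ⟩
    concatMap (λ x → List.map (h x ∷_) T) xs
      ≡⟨ Listₚ.concatMap-cong (λ x → trans (sym (Listₚ.map-∘ (tuples xs k))) (Listₚ.map-∘ (tuples xs k))) xs ⟩
    concatMap (λ x → List.map (Vec.map h) (List.map (x ∷_) (tuples xs k))) xs
      ≡⟨ Listₚ.map-concatMap (Vec.map h) _ xs ⟨
    List.map (Vec.map h) (tuples xs (suc k)) ∎
    where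
    open ≡.≡-Reasoning
    T = List.map (Vec.map h) (tuples xs k)

  permTuples≡tuples : ∀ n k → permTuples n k ≡ tuples (perms n) k
  permTuples≡tuples n zero    = refl
  permTuples≡tuples n (suc k) = cong (λ T → concatMap (λ σ → List.map (σ ∷_) T) (perms n)) (permTuples≡tuples n k)

module PermutationVectors where
  open ≡ using (refl; sym; trans)
  open Tuples using (concatMap≡cartesianProductWith)

  IsPermutation : ∀ {n} → Vec (Fin n) n → Set
  IsPermutation v = Injective _≡_ _≡_ (lookup v)

  injective⇒surjective : ∀ {n} {f : Fin n → Fin n} → Injective _≡_ _≡_ f → ∀ t → ∃ λ p → f p ≡ t
  injective⇒surjective {suc n} {f} f-injective t with Finₚ.any? (λ p → f p ≟ t)
  ... | yes hit  = hit
  ... | no  miss = contradiction (Finₚ.injective⇒≤ g-injective) ℕₚ.1+n≰n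
    where
    g : Fin (suc n) → Fin n
    g p = punchOut {i = t} (λ t≡fp → miss (p , sym t≡fp))
    g-injective : Injective _≡_ _≡_ g
    g-injective gp≡gq = f-injective (Finₚ.punchOut-injective {i = t} _ _ gp≡gq)

  lookup-ext : ∀ {A : Set} {n} {xs ys : Vec A n} → (∀ k → lookup xs k ≡ lookup ys k) → xs ≡ ys
  lookup-ext {xs = xs} {ys} eq = trans (sym (Vecₚ.tabulate∘lookup xs)) (trans (Vecₚ.tabulate-cong eq) (Vecₚ.tabulate∘lookup ys))

  data Position {n} (p : Fin (suc n)) : Fin (suc n) → Set where
    at    : Position p p
    other : ∀ k → Position p (punchIn p k)

  position : ∀ {n} (p a : Fin (suc n)) → Position p a
  position p a with a ≟ p
  ... | yes refl = at
  ... | no  a≢p  = subst (Position p) (Finₚ.punchIn-punchOut (a≢p ∘ sym)) (other _)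

  insertAt≡ : ∀ {A : Set} {n} p (a : A) (xs : Vec A n) → insertAt p a xs ≡ Vec.insertAt xs p a
  insertAt≡ zero    a xs       = refl
  insertAt≡ (suc p) a (x ∷ xs) = cong (x ∷_) (insertAt≡ p a xs)

  insertTop : ∀ {n} → Fin (suc n) → Vec (Fin n) n → Vec (Fin (suc n)) (suc n)
  insertTop {n} p v = insertAt p (fromℕ n) (Vec.map inject₁ v)

  permVecs-suc : ∀ n → permVecs (suc n) ≡ List.cartesianProductWith (λ v p → insertTop p v) (permVecs n) (allFin (suc n))
  permVecs-suc n = concatMap≡cartesianProductWith (λ v p → insertTop p v) (permVecs n) (allFin (suc n))

  lookup-insertTop : ∀ {n} p (v : Vec (Fin n) n) → lookup (insertTop p v) p ≡ fromℕ n
  lookup-insertTop p v = trans (cong (λ w → lookup w p) (insertAt≡ p _ _)) (Vecₚ.insertAt-lookup _ p _)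

  lookup-insertTop-punchIn : ∀ {n} p (v : Vec (Fin n) n) k → lookup (insertTop p v) (punchIn p k) ≡ inject₁ (lookup v k)
  lookup-insertTop-punchIn p v k = trans (cong (λ w → lookup w (punchIn p k)) (insertAt≡ p _ _))
    (trans (Vecₚ.insertAt-punchIn _ p _ k) (Vecₚ.lookup-map k inject₁ v))

  removeAt-insertTop : ∀ {n} p (v : Vec (Fin n) n) → removeAt (insertTop p v) p ≡ Vec.map inject₁ v
  removeAt-insertTop p v = trans (cong (λ w → removeAt w p) (insertAt≡ p _ _)) (Vecₚ.removeAt-insertAt _ p _)

  insertTop-preserves-permutation : ∀ {n} p {v : Vec (Fin n) n} → IsPermutation v → IsPermutation (insertTop p v)
  insertTop-preserves-permutation p {v} v-perm {a} {b} eq with position p a | position p b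
  ... | at      | at      = refl
  ... | at      | other k = contradiction (trans (sym (lookup-insertTop p v)) (trans eq (lookup-insertTop-punchIn p v k)))
                                          Finₚ.fromℕ≢inject₁
  ... | other k | at      = contradiction (trans (sym (lookup-insertTop p v)) (trans (sym eq) (lookup-insertTop-punchIn p v k)))
                                          Finₚ.fromℕ≢inject₁
  ... | other k | other l = cong (punchIn p) (v-perm (Finₚ.inject₁-injective
          (trans (sym (lookup-insertTop-punchIn p v k)) (trans eq (lookup-insertTop-punchIn p v l)))))

  insertTop-cancel : ∀ {n} {p q} {v w : Vec (Fin n) n} → insertTop p v ≡ insertTop q w → v ≡ w × p ≡ q
  insertTop-cancel {p = p} {q} {v} {w} eq with position q p
  ... | at      = lookup-ext (λ k → Finₚ.inject₁-injective (trans (sym (Vecₚ.lookup-map k inject₁ v))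
                    (trans (cong (λ z → lookup z k) inject-v≡inject-w) (Vecₚ.lookup-map k inject₁ w)))) , refl
    where
    inject-v≡inject-w : Vec.map inject₁ v ≡ Vec.map inject₁ w
    inject-v≡inject-w = trans (sym (removeAt-insertTop q v)) (trans (cong (λ z → removeAt z q) eq) (removeAt-insertTop q w))
  ... | other k = contradiction (trans (sym (lookup-insertTop (punchIn q k) v))
                    (trans (cong (λ z → lookup z (punchIn q k)) eq) (lookup-insertTop-punchIn q w k))) Finₚ.fromℕ≢inject₁

  ∈permVecs⇒isPermutation : ∀ {n} {v : Vec (Fin n) n} → v ∈ permVecs n → IsPermutation v
  ∈permVecs⇒isPermutation {zero}  {[]} _ {()}
  ∈permVecs⇒isPermutation {suc n} v∈
    with u , p , u∈ , _ , refl ← ∈-cartesianProductWith⁻ (λ v p → insertTop p v) (permVecs n) (allFin (suc n))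
                                   (subst (_ ∈_) (permVecs-suc n) v∈)
    = insertTop-preserves-permutation p (∈permVecs⇒isPermutation u∈)

  isPermutation⇒∈permVecs : ∀ {n} {w : Vec (Fin n) n} → IsPermutation w → w ∈ permVecs n
  isPermutation⇒∈permVecs {zero}  {[]} _ = here refl
  isPermutation⇒∈permVecs {suc n} {w} w-perm = subst (_∈ permVecs (suc n)) insertTop-u≡w
    (subst (insertTop p u ∈_) (sym (permVecs-suc n))
      (∈-cartesianProductWith⁺ (λ v p → insertTop p v) (isPermutation⇒∈permVecs {w = u} u-perm) (∈-allFin p)))
    where
    p = proj₁ (injective⇒surjective w-perm (fromℕ n))
    wp≡top = proj₂ (injective⇒surjective w-perm (fromℕ n))
    rest = removeAt w p
    lookup-rest : ∀ k → lookup rest k ≡ lookup w (punchIn p k)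
    lookup-rest k = trans (cong (lookup rest) (sym (Finₚ.punchOut-punchIn p))) (Vecₚ.removeAt-punchOut w _)
    rest≢top : ∀ k → n ≢ toℕ (lookup rest k)
    rest≢top k n≡ = Finₚ.punchInᵢ≢i p k (w-perm (trans (sym (lookup-rest k))
      (trans (Finₚ.toℕ-injective (trans (sym n≡) (sym (Finₚ.toℕ-fromℕ n)))) (sym wp≡top))))
    u : Vec (Fin n) n
    u = tabulate (λ k → lower₁ (lookup rest k) (rest≢top k))
    inject-u : ∀ k → inject₁ (lookup u k) ≡ lookup rest k
    inject-u k = trans (cong inject₁ (Vecₚ.lookup∘tabulate _ k)) (Finₚ.inject₁-lower₁ _ (rest≢top k))
    u-perm : IsPermutation u
    u-perm {a} {b} ua≡ub = Finₚ.punchIn-injective p a b (w-perm (trans (sym (lookup-rest a))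
      (trans (sym (inject-u a)) (trans (cong inject₁ ua≡ub) (trans (inject-u b) (lookup-rest b))))))
    insertTop-u≡w : insertTop p u ≡ w
    insertTop-u≡w = begin
      insertAt p (fromℕ n) (Vec.map inject₁ u) ≡⟨ cong₂ (insertAt p) (sym wp≡top)
                                                   (lookup-ext λ k → trans (Vecₚ.lookup-map k inject₁ u) (inject-u k)) ⟩
      insertAt p (lookup w p) rest              ≡⟨ insertAt≡ p _ rest ⟩
      Vec.insertAt rest p (lookup w p)          ≡⟨ Vecₚ.insertAt-removeAt w p ⟩
      w                                         ∎
      where open ≡.≡-Reasoning

  permVecs-unique : ∀ n → Unique (permVecs n)
  permVecs-unique zero    = ListAll.[] ∷ []
  permVecs-unique (suc n) = subst Unique (sym (permVecs-suc n))
    (Uniqueₚ.cartesianProductWith⁺ _ insertTop-cancel (permVecs-unique n) (Uniqueₚ.allFin⁺ (suc n)))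

module Selection where
  open ≡ using (refl; sym; trans)

  private variable
    X : Set
    k : ℕ

  merge : Vec Bool k → Vec X k → Vec X k → Vec X k
  merge []          []       []       = []
  merge (true  ∷ B) (x ∷ xs) (y ∷ ys) = y ∷ merge B xs ys
  merge (false ∷ B) (x ∷ xs) (y ∷ ys) = x ∷ merge B xs ys

  merge-same : ∀ (B : Vec Bool k) (xs : Vec X k) → merge B xs xs ≡ xs
  merge-same []          []       = refl
  merge-same (true  ∷ B) (x ∷ xs) = cong (x ∷_) (merge-same B xs)
  merge-same (false ∷ B) (x ∷ xs) = cong (x ∷_) (merge-same B xs)

  merge-complement : ∀ (B : Vec Bool k) (xs ys : Vec X k) → merge (complement B) xs ys ≡ merge B ys xs
  merge-complement []          []       []       = refl
  merge-complement (true  ∷ B) (x ∷ xs) (y ∷ ys) = cong (x ∷_) (merge-complement B xs ys)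
  merge-complement (false ∷ B) (x ∷ xs) (y ∷ ys) = cong (y ∷_) (merge-complement B xs ys)

  select-merge : ∀ (B : Vec Bool k) (xs ys : Vec X k) → select B (merge B xs ys) ≡ select B ys
  select-merge []          []       []       = refl
  select-merge (true  ∷ B) (x ∷ xs) (y ∷ ys) = cong (y ∷_) (select-merge B xs ys)
  select-merge (false ∷ B) (x ∷ xs) (y ∷ ys) = select-merge B xs ys

  select-complement-merge : ∀ (B : Vec Bool k) (xs ys : Vec X k) →
                            select (complement B) (merge B xs ys) ≡ select (complement B) xs
  select-complement-merge []          []       []       = refl
  select-complement-merge (true  ∷ B) (x ∷ xs) (y ∷ ys) = select-complement-merge B xs ys
  select-complement-merge (false ∷ B) (x ∷ xs) (y ∷ ys) = cong (x ∷_) (select-complement-merge B xs ys)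

  merge-none : ∀ (xs ys : Vec X k) → merge (replicate k false) xs ys ≡ xs
  merge-none []       []       = refl
  merge-none (x ∷ xs) (y ∷ ys) = cong (x ∷_) (merge-none xs ys)

  merge-all : ∀ (xs ys : Vec X k) → merge (replicate k true) xs ys ≡ ys
  merge-all []       []       = refl
  merge-all (x ∷ xs) (y ∷ ys) = cong (y ∷_) (merge-all xs ys)

  count-none : ∀ k → count (replicate k false) ≡ 0
  count-none zero    = refl
  count-none (suc k) = count-none k

  count-all : ∀ k → count (replicate k true) ≡ k
  count-all zero    = refl
  count-all (suc k) = cong suc (count-all k)

  count-complement-all : ∀ k → count (complement (replicate k true)) ≡ 0
  count-complement-all zero    = refl
  count-complement-all (suc k) = count-complement-all k

  -- inverse of `select (replicate k true)`, whose result length is only propositionally k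
  unselectAll : ∀ k → Vec X (count (replicate k true)) → Vec X k
  unselectAll zero    []       = []
  unselectAll (suc k) (x ∷ xs) = x ∷ unselectAll k xs

  unselectAll-select : ∀ (xs : Vec X k) → unselectAll k (select (replicate k true) xs) ≡ xs
  unselectAll-select []       = refl
  unselectAll-select (x ∷ xs) = cong (x ∷_) (unselectAll-select xs)

  singleton : Fin k → Vec Bool k
  singleton zero    = true ∷ replicate _ false
  singleton (suc p) = false ∷ singleton p

  count-singleton : ∀ (p : Fin k) → count (singleton p) ≡ 1
  count-singleton {suc k} zero    = cong suc (count-none k)
  count-singleton         (suc p) = count-singleton p

  lookup-merge-singleton : ∀ (p : Fin k) (xs ys : Vec X k) → lookup (merge (singleton p) xs ys) p ≡ lookup ys p
  lookup-merge-singleton zero    (x ∷ xs) (y ∷ ys) = refl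
  lookup-merge-singleton (suc p) (x ∷ xs) (y ∷ ys) = lookup-merge-singleton p xs ys

  removeAt-merge-singleton : ∀ (p : Fin (suc k)) (xs ys : Vec X (suc k)) →
                             removeAt (merge (singleton p) xs ys) p ≡ removeAt xs p
  removeAt-merge-singleton zero (x ∷ xs) (y ∷ ys) = merge-none xs ys
  removeAt-merge-singleton (suc zero) (x ∷ x′ ∷ xs) (y ∷ y′ ∷ ys) = cong (x ∷_) (merge-none xs ys)
  removeAt-merge-singleton (suc (suc p)) (x ∷ x′ ∷ xs) (y ∷ y′ ∷ ys) =
    cong (x ∷_) (removeAt-merge-singleton (suc p) (x′ ∷ xs) (y′ ∷ ys))

module Transposition where
  open ≡ using (refl; sym; trans)
  open Selection using (merge)
  open PermutationVectors using (IsPermutation; lookup-ext)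

  private variable
    A : Set
    n k : ℕ

  transpose-ˡ : ∀ (i j : Fin n) → transpose i j i ≡ j
  transpose-ˡ i j rewrite dec-true (i ≟ i) refl = refl

  transpose-ʳ : ∀ (i j : Fin n) → transpose i j j ≡ i
  transpose-ʳ i j with j ≟ i
  ... | yes j≡i = j≡i
  ... | no  _   rewrite dec-true (j ≟ j) refl = refl

  transpose-other : ∀ {i j m : Fin n} → m ≢ i → m ≢ j → transpose i j m ≡ m
  transpose-other {i = i} {j} {m} m≢i m≢j rewrite dec-false (m ≟ i) m≢i | dec-false (m ≟ j) m≢j = refl

  transpose-involutive : ∀ (i j m : Fin n) → transpose i j (transpose i j m) ≡ m
  transpose-involutive i j m = by-cases (m ≟ i) (m ≟ j)
    where
    by-cases : Dec (m ≡ i) → Dec (m ≡ j) → transpose i j (transpose i j m) ≡ m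
    by-cases (yes refl) _          = trans (cong (transpose i j) (transpose-ˡ i j)) (transpose-ʳ i j)
    by-cases (no  _)    (yes refl) = trans (cong (transpose i j) (transpose-ʳ i j)) (transpose-ˡ i j)
    by-cases (no  m≢i)  (no  m≢j)  = trans (cong (transpose i j) (transpose-other m≢i m≢j)) (transpose-other m≢i m≢j)

  swapEntries : Fin n → Fin n → Vec A n → Vec A n
  swapEntries i j v = tabulate (λ m → lookup v (transpose i j m))

  lookup-swapEntries : ∀ (i j : Fin n) (v : Vec A n) m → lookup (swapEntries i j v) m ≡ lookup v (transpose i j m)
  lookup-swapEntries i j v = Vecₚ.lookup∘tabulate _

  swapEntries-involutive : ∀ (i j : Fin n) (v : Vec A n) → swapEntries i j (swapEntries i j v) ≡ v
  swapEntries-involutive i j v = lookup-ext λ m →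
    trans (lookup-swapEntries i j (swapEntries i j v) m)
      (trans (lookup-swapEntries i j v (transpose i j m)) (cong (lookup v) (transpose-involutive i j m)))

  swapSelected : Fin n → Fin n → Vec Bool k → Vec (Vec A n) k → Vec (Vec A n) k
  swapSelected i j []          []       = []
  swapSelected i j (true  ∷ B) (v ∷ vs) = swapEntries i j v ∷ swapSelected i j B vs
  swapSelected i j (false ∷ B) (v ∷ vs) = v ∷ swapSelected i j B vs

  swapSelected-involutive : ∀ (i j : Fin n) (B : Vec Bool k) (vs : Vec (Vec A n) k) →
                            swapSelected i j B (swapSelected i j B vs) ≡ vs
  swapSelected-involutive i j []          []       = refl
  swapSelected-involutive i j (true  ∷ B) (v ∷ vs) = cong₂ _∷_ (swapEntries-involutive i j v) (swapSelected-involutive i j B vs)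
  swapSelected-involutive i j (false ∷ B) (v ∷ vs) = cong (v ∷_) (swapSelected-involutive i j B vs)

  swapSelected-all : ∀ {P : Vec A n → Set} (i j : Fin n) → (∀ {v} → P v → P (swapEntries i j v)) →
                     ∀ (B : Vec Bool k) {vs} → VecAll.All P vs → VecAll.All P (swapSelected i j B vs)
  swapSelected-all i j swap-P []          VecAll.[]          = VecAll.[]
  swapSelected-all i j swap-P (true  ∷ B) (Pv VecAll.∷ Pvs) = swap-P Pv VecAll.∷ swapSelected-all i j swap-P B Pvs
  swapSelected-all i j swap-P (false ∷ B) (Pv VecAll.∷ Pvs) = Pv VecAll.∷ swapSelected-all i j swap-P B Pvs

  -- for a tuple (σ₂, …, σ_d), the trailing indices (σ₂ m, …, σ_d m) of the m-th factor of a term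
  row : Vec (Vec A n) k → Fin n → Vec A k
  row vs m = Vec.map (λ v → lookup v m) vs

  row-swapSelected : ∀ (i j : Fin n) (B : Vec Bool k) (vs : Vec (Vec A n) k) m →
                     row (swapSelected i j B vs) m ≡ merge B (row vs m) (row vs (transpose i j m))
  row-swapSelected i j []          []       m = refl
  row-swapSelected i j (true  ∷ B) (v ∷ vs) m = cong₂ _∷_ (lookup-swapEntries i j v m) (row-swapSelected i j B vs m)
  row-swapSelected i j (false ∷ B) (v ∷ vs) m = cong (lookup v m ∷_) (row-swapSelected i j B vs m)

  swapEntries-isPermutation : ∀ (i j : Fin n) {v : Vec (Fin n) n} → IsPermutation v → IsPermutation (swapEntries i j v)
  swapEntries-isPermutation i j {v} v-perm {a} {b} eq = trans (sym (transpose-involutive i j a))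
    (trans (cong (transpose i j) (v-perm (trans (sym (lookup-swapEntries i j v a)) (trans eq (lookup-swapEntries i j v b)))))
           (transpose-involutive i j b))

  swapEntries-moves : ∀ {i j : Fin n} {v : Vec (Fin n) n} → IsPermutation v → i ≢ j → swapEntries i j v ≢ v
  swapEntries-moves {i = i} {j} {v} v-perm i≢j eq = i≢j (sym (v-perm (trans
    (sym (trans (lookup-swapEntries i j v i) (cong (lookup v) (transpose-ˡ i j))))
    (cong (λ w → lookup w i) eq))))

  swapSelected-fixed : ∀ {i j : Fin n} → i ≢ j → (B : Vec Bool k) {vs : Vec (Vec (Fin n) n) k} →
                       VecAll.All IsPermutation vs → swapSelected i j B vs ≡ vs → count B ≡ 0
  swapSelected-fixed i≢j []          VecAll.[]         _  = refl
  swapSelected-fixed i≢j (true  ∷ B) (p VecAll.∷ _)  eq = contradiction (Vecₚ.∷-injectiveˡ eq) (swapEntries-moves p i≢j)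
  swapSelected-fixed i≢j (false ∷ B) (_ VecAll.∷ ps) eq = swapSelected-fixed i≢j B ps (Vecₚ.∷-injectiveʳ eq)

module InversionParity where
  open ≡ using (refl; sym; trans)
  open import Algebra.Solver.Ring.AlmostCommutativeRing using (fromCommutativeRing)
  open import Algebra.Solver.Ring.Simple (fromCommutativeRing Boolₚ.xor-∧-commutativeRing) Boolₚ._≟_
    using (solve; _:+_; _:*_; _:=_; con)
  open Sums (CommutativeRing.+-commutativeMonoid Boolₚ.xor-∧-commutativeRing)
    using (sum-syntax; ∑L; ∑L-allFin; ∑-distrib-+; sum-pair; sum-cong-≋)
  open import Data.Nat using (_%_)

  isOdd : ℕ → Bool
  isOdd zero    = false
  isOdd (suc m) = not (isOdd m)

  isOdd-+ : ∀ m k → isOdd (m ℕ.+ k) ≡ isOdd m xor isOdd k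
  isOdd-+ zero    k = refl
  isOdd-+ (suc m) k = trans (cong not (isOdd-+ m k)) (Boolₚ.not-distribˡ-xor (isOdd m) (isOdd k))

  isOdd-sum : ∀ {A : Set} (f : A → ℕ) xs → isOdd (sumℕ (List.map f xs)) ≡ ∑L (isOdd ∘ f) xs
  isOdd-sum f []       = refl
  isOdd-sum f (x ∷ xs) = trans (isOdd-+ (f x) _) (cong (isOdd (f x) xor_) (isOdd-sum f xs))

  %2≡isOdd : ∀ m → m % 2 ≡ (if isOdd m then 1 else 0)
  %2≡isOdd zero          = refl
  %2≡isOdd (suc zero)    = refl
  %2≡isOdd (suc (suc m)) = trans (%2≡isOdd m) (cong (λ b → if b then 1 else 0) (sym (Boolₚ.not-involutive (isOdd m))))

  odd⇒isOdd : ∀ {m} → Odd m → isOdd m ≡ true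
  odd⇒isOdd {m} odd with isOdd m | %2≡isOdd m
  ... | true  | _       = refl
  ... | false | m%2≡0   = contradiction (trans (sym odd) m%2≡0) λ ()

  even⇒odd-pred : ∀ k → Even (suc k) → Odd k
  even⇒odd-pred zero          ()
  even⇒odd-pred (suc zero)    _    = refl
  even⇒odd-pred (suc (suc k)) even = even⇒odd-pred k even

  isInversion : ∀ {n} → (Fin n → Fin n) → Fin n → Fin n → Bool
  isInversion σ a b = does (a <? b) ∧ does (σ b <? σ a)

  inversionParity : ∀ {n} → (Fin n → Fin n) → Bool
  inversionParity {n} σ = ∑[ a < n ] ∑[ b < n ] isInversion σ a b

  -- `inversions` sums a local `with`-function of Defs; unification recovers it as a first component
  inversionSummand : ∀ {n} (σ : Perm n) → Σ (Fin n → Fin n → ℕ) λ c →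
                     inversions σ ≡ sumℕ (List.map (λ a → sumℕ (List.map (c a) (allFin n))) (allFin n))
  inversionSummand σ = _ , refl

  isOdd-inversionSummand : ∀ {n} (σ : Perm n) a b → isOdd (proj₁ (inversionSummand σ) a b) ≡ isInversion σ a b
  isOdd-inversionSummand σ a b with a <? b | σ b <? σ a
  ... | yes a<b | yes σb<σa = sym (cong₂ _∧_ (dec-true (a <? b) a<b) (dec-true (σ b <? σ a) σb<σa))
  ... | yes a<b | no  σb≮σa = sym (cong₂ _∧_ (dec-true (a <? b) a<b) (dec-false (σ b <? σ a) σb≮σa))
  ... | no  a≮b | _         = sym (cong (_∧ does (σ b <? σ a)) (dec-false (a <? b) a≮b))

  isOdd-inversions : ∀ {n} (σ : Perm n) → isOdd (inversions σ) ≡ inversionParity σ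
  isOdd-inversions {n} σ = begin
    isOdd (inversions σ)                                 ≡⟨ cong isOdd (proj₂ (inversionSummand σ)) ⟩
    isOdd (sumℕ (List.map (λ a → sumℕ (List.map (c a) (allFin n))) (allFin n)))
                                                         ≡⟨ isOdd-sum _ (allFin n) ⟩
    ∑L (λ a → isOdd (sumℕ (List.map (c a) (allFin n)))) (allFin n)
                                                         ≡⟨ ∑L-allFin (λ a → isOdd (sumℕ (List.map (c a) (allFin n)))) ⟩
    ∑[ a < n ] isOdd (sumℕ (List.map (c a) (allFin n)))  ≡⟨ sum-cong-≋ (λ a → trans (isOdd-sum (c a) (allFin n))
                                                              (trans (∑L-allFin (isOdd ∘ c a)) (sum-cong-≋ (isOdd-inversionSummand σ a)))) ⟩
    inversionParity σ                                    ∎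
    where
    open ≡.≡-Reasoning
    c = proj₁ (inversionSummand σ)

  crossSum : ∀ {n} (K : Fin n → Fin n → Bool) {i j} → i ≢ j →
             (∀ a b → a ≢ i → a ≢ j → b ≢ i → b ≢ j → K a b ≡ false) →
             (∀ b → b ≢ i → b ≢ j → (K i b xor K j b) xor (K b i xor K b j) ≡ false) →
             ∑[ a < n ] ∑[ b < n ] K a b ≡ (K i i xor K i j) xor (K j i xor K j j)
  crossSum {n} K {i} {j} i≢j outside cross = begin
    ∑r                                             ≡⟨ regroup ∑r ∑c (r i) (r j) ⟩
    ((∑r xor ∑c) xor ((r i xor r j) xor ∑c)) xor (r i xor r j)
                                                   ≡⟨ cong₂ (λ p q → (p xor q) xor (r i xor r j)) rows-and-columns crosses ⟩
    (((r i xor c i) xor (r j xor c j)) xor (E i xor E j)) xor (r i xor r j)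
                                                   ≡⟨ corner (r i) (r j) (K i i) (K i j) (K j i) (K j j) ⟩
    (K i i xor K i j) xor (K j i xor K j j)        ∎
    where
    open ≡.≡-Reasoning
    r c E : Fin n → Bool
    r a = ∑[ b < n ] K a b
    c a = K a i xor K a j
    E b = (K i b xor K j b) xor c b
    ∑r = ∑[ a < n ] r a
    ∑c = ∑[ a < n ] c a

    rows-and-columns : ∑r xor ∑c ≡ (r i xor c i) xor (r j xor c j)
    rows-and-columns = trans (sym (∑-distrib-+ r c)) (sum-pair i≢j λ a a≢i a≢j →
      trans (cong (_xor c a) (sum-pair i≢j λ b b≢i b≢j → outside a b a≢i a≢j b≢i b≢j)) (Boolₚ.xor-same (c a)))

    crosses : (r i xor r j) xor ∑c ≡ E i xor E j
    crosses = trans (cong (_xor ∑c) (sym (∑-distrib-+ (K i) (K j))))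
                    (trans (sym (∑-distrib-+ _ c)) (sum-pair i≢j cross))

    regroup : ∀ x y u v → x ≡ ((x xor y) xor ((u xor v) xor y)) xor (u xor v)
    regroup = solve 4 (λ x y u v → x := ((x :+ y) :+ ((u :+ v) :+ y)) :+ (u :+ v)) refl

    corner : ∀ u v a b c d → (((u xor (a xor b)) xor (v xor (c xor d))) xor
                              (((a xor c) xor (a xor b)) xor ((b xor d) xor (c xor d)))) xor (u xor v)
                             ≡ (a xor b) xor (c xor d)
    corner = solve 6 (λ u v a b c d → (((u :+ (a :+ b)) :+ (v :+ (c :+ d))) :+
                                       (((a :+ c) :+ (a :+ b)) :+ ((b :+ d) :+ (c :+ d)))) :+ (u :+ v)
                                      := (a :+ b) :+ (c :+ d)) refl

  <?-irrefl : ∀ {n} (a : Fin n) → does (a <? a) ≡ false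
  <?-irrefl a = dec-false (a <? a) (Finₚ.<-irrefl refl)

  <?-flip : ∀ {n} {a b : Fin n} → a ≢ b → does (b <? a) ≡ not (does (a <? b))
  <?-flip {a = a} {b} a≢b with Finₚ.<-cmp a b
  ... | tri< a<b _   _   = trans (dec-false (b <? a) (Finₚ.<-asym a<b)) (cong not (sym (dec-true (a <? b) a<b)))
  ... | tri≈ _   a≡b _   = contradiction a≡b a≢b
  ... | tri> _   _   b<a = trans (dec-true (b <? a) b<a) (cong not (sym (dec-false (a <? b) (Finₚ.<-asym b<a))))

  inversionParity-swap : ∀ {n} {σ σ′ : Fin n → Fin n} {i j} → Injective _≡_ _≡_ σ → i ≢ j →
                         σ′ i ≡ σ j → σ′ j ≡ σ i → (∀ m → m ≢ i → m ≢ j → σ′ m ≡ σ m) →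
                         inversionParity σ′ ≡ not (inversionParity σ)
  inversionParity-swap {n} {σ} {σ′} {i} {j} σ-injective i≢j σ′i σ′j σ′-off =
    trans (cancel (inversionParity σ) (inversionParity σ′)) (cong (_xor inversionParity σ) flipped)
    where
    open ≡.≡-Reasoning
    K : Fin n → Fin n → Bool
    K a b = isInversion σ a b xor isInversion σ′ a b

    σ≢ : ∀ {a b} → a ≢ b → σ a ≢ σ b
    σ≢ a≢b = a≢b ∘ σ-injective

    outside : ∀ a b → a ≢ i → a ≢ j → b ≢ i → b ≢ j → K a b ≡ false
    outside a b a≢i a≢j b≢i b≢j rewrite σ′-off a a≢i a≢j | σ′-off b b≢i b≢j = Boolₚ.xor-same (isInversion σ a b)

    cross-identity : ∀ x₁ x₂ u₁ u₂ →
      (((x₁ ∧ u₁) xor (x₁ ∧ u₂)) xor ((x₂ ∧ u₂) xor (x₂ ∧ u₁))) xor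
      (((not x₁ ∧ not u₁) xor (not x₁ ∧ not u₂)) xor ((not x₂ ∧ not u₂) xor (not x₂ ∧ not u₁))) ≡ false
    cross-identity = solve 4 (λ x₁ x₂ u₁ u₂ →
      (((x₁ :* u₁) :+ (x₁ :* u₂)) :+ ((x₂ :* u₂) :+ (x₂ :* u₁))) :+
      ((((con true :+ x₁) :* (con true :+ u₁)) :+ ((con true :+ x₁) :* (con true :+ u₂))) :+
       (((con true :+ x₂) :* (con true :+ u₂)) :+ ((con true :+ x₂) :* (con true :+ u₁))))
      := con false) refl

    corner-identity : ∀ x u → ((x ∧ u) xor (x ∧ not u)) xor (((not x ∧ not u) xor (not x ∧ u)) xor false) ≡ true
    corner-identity = solve 2 (λ x u →
      ((x :* u) :+ (x :* (con true :+ u))) :+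
      ((((con true :+ x) :* (con true :+ u)) :+ ((con true :+ x) :* u)) :+ con false)
      := con true) refl

    cross : ∀ b → b ≢ i → b ≢ j → (K i b xor K j b) xor (K b i xor K b j) ≡ false
    cross b b≢i b≢j rewrite σ′i | σ′j | σ′-off b b≢i b≢j
      | <?-flip (b≢i ∘ sym) | <?-flip (b≢j ∘ sym) | <?-flip (σ≢ b≢i) | <?-flip (σ≢ b≢j)
      = cross-identity (does (i <? b)) (does (j <? b)) (does (σ b <? σ i)) (does (σ b <? σ j))

    corner : (K i i xor K i j) xor (K j i xor K j j) ≡ true
    corner rewrite σ′i | σ′j | <?-irrefl i | <?-irrefl j | <?-flip i≢j | <?-flip (σ≢ (i≢j ∘ sym))
      = corner-identity (does (i <? j)) (does (σ j <? σ i))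

    flipped : inversionParity σ xor inversionParity σ′ ≡ true
    flipped = begin
      inversionParity σ xor inversionParity σ′
                                               ≡⟨ ∑-distrib-+ (λ a → ∑[ b < n ] isInversion σ a b) (λ a → ∑[ b < n ] isInversion σ′ a b) ⟨
      ∑[ a < n ] (∑[ b < n ] isInversion σ a b xor ∑[ b < n ] isInversion σ′ a b)
                                               ≡⟨ sum-cong-≋ (λ a → ∑-distrib-+ (isInversion σ a) (isInversion σ′ a)) ⟨
      ∑[ a < n ] ∑[ b < n ] K a b              ≡⟨ crossSum K i≢j outside cross ⟩
      (K i i xor K i j) xor (K j i xor K j j)  ≡⟨ corner ⟩
      true                                     ∎

    cancel : ∀ x y → y ≡ (x xor y) xor x
    cancel = solve 2 (λ x y → y := (x :+ y) :+ x) refl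

module ProductsOfSums {c ℓ} (R : CommutativeSemiring c ℓ) where
  open CommutativeSemiring R hiding (zero)
  open import Relation.Binary.Reasoning.Setoid setoid
  open Sums +-commutativeMonoid using (∑L; ∑L-cong; ∑L-map; ∑L-concatMap)
  open Sums *-commutativeMonoid using () renaming (sum to ∏)
  open Tuples using (tuples)

  private variable A : Set

  *-distribˡ-∑L : ∀ x (f : A → Carrier) xs → x * ∑L f xs ≈ ∑L (λ y → x * f y) xs
  *-distribˡ-∑L x f []       = zeroʳ x
  *-distribˡ-∑L x f (y ∷ ys) = trans (distribˡ x (f y) _) (+-congˡ (*-distribˡ-∑L x f ys))

  *-distribʳ-∑L : ∀ x (f : A → Carrier) xs → ∑L f xs * x ≈ ∑L (λ y → f y * x) xs
  *-distribʳ-∑L x f []       = zeroˡ x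
  *-distribʳ-∑L x f (y ∷ ys) = trans (distribʳ x (f y) _) (+-congˡ (*-distribʳ-∑L x f ys))

  ∏-∑L-expand : ∀ n (a : Fin n → A → Carrier) ys →
                ∏ (λ m → ∑L (a m) ys) ≈ ∑L (λ t → ∏ (λ m → a m (lookup t m))) (tuples ys n)
  ∏-∑L-expand zero    a ys = sym (+-identityʳ 1#)
  ∏-∑L-expand (suc n) a ys = begin
    ∑L (a zero) ys * ∏ (λ m → ∑L (a (suc m)) ys)       ≈⟨ *-congˡ (∏-∑L-expand n (a ∘ suc) ys) ⟩
    ∑L (a zero) ys * ∑L rest T                          ≈⟨ *-distribʳ-∑L _ (a zero) ys ⟩
    ∑L (λ y → a zero y * ∑L rest T) ys                  ≈⟨ ∑L-cong {xs = ys} (λ {y} _ → *-distribˡ-∑L (a zero y) rest T) ⟩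
    ∑L (λ y → ∑L (λ t → a zero y * rest t) T) ys        ≈⟨ ∑L-cong {xs = ys} (λ {y} _ → reflexive (≡.sym (∑L-map {f = G} (y ∷_) T))) ⟩
    ∑L (λ y → ∑L G (List.map (y ∷_) T)) ys              ≈⟨ sym (∑L-concatMap (λ y → List.map (y ∷_) T) ys) ⟩
    ∑L G (tuples ys (suc n))                            ∎
    where
    G : Vec _ (suc n) → Carrier
    G t = ∏ (λ m → a m (lookup t m))
    T = tuples ys n
    rest : Vec _ n → Carrier
    rest t = ∏ (λ m → a (suc m) (lookup t m))

module Hyperdeterminant {c ℓ} (F : Field c ℓ) where
  open Field F hiding (zero)
  open import Relation.Binary.Reasoning.Setoid setoid
  import Algebra.Properties.Ring ring as Ringₚ
  open import Algebra.Properties.CommutativeSemigroup *-commutativeSemigroup using (interchange; x∙yz≈y∙xz)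
  open Sums +-commutativeMonoid
    using (∑L; ∑L-cong; ∑L-zero; ∑L-map; ∑L-comm; ∑L-cancel; ∑L-allFin; sum-syntax; sum-single; sum-remove)
  open Sums *-commutativeMonoid using ()
    renaming (sum to ∏; ∑L to ∏L; ∑L-allFin to ∏L-allFin; sum-cong-≋ to ∏-cong; sum-cong-off₂ to ∏-cong-off₂)
  open ProductsOfSums commutativeSemiring using (*-distribˡ-∑L; ∏-∑L-expand)
  open Tuples
  open PermutationVectors
  open Selection
  open Transposition
  open InversionParity using (isOdd; odd⇒isOdd; inversionParity; isOdd-inversions; inversionParity-swap; %2≡isOdd)

  private variable k n : ℕ

  sign : Bool → Carrier
  sign false = 1#
  sign true  = - 1#

  sign-not : ∀ b → sign (not b) ≈ - sign b
  sign-not false = refl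
  sign-not true  = sym (Ringₚ.-‿involutive 1#)

  sgn≡sign : (σ : Perm n) → sgn F σ ≡ sign (inversionParity σ)
  sgn≡sign σ = ≡.trans sgn-by-parity (cong sign (isOdd-inversions σ))
    where
    sgn-by-parity : sgn F σ ≡ sign (isOdd (inversions σ))
    sgn-by-parity with isOdd (inversions σ) | %2≡isOdd (inversions σ)
    ... | false | m%2≡0 rewrite m%2≡0 = ≡.refl
    ... | true  | m%2≡1 rewrite m%2≡1 = ≡.refl

  sgn-swapEntries : ∀ {i j : Fin n} → i ≢ j → {v : Vec (Fin n) n} → IsPermutation v →
                    sgn F (lookup (swapEntries i j v)) ≈ - sgn F (lookup v)
  sgn-swapEntries {i = i} {j} i≢j {v} v-perm = begin
    sgn F (lookup (swapEntries i j v))                  ≡⟨ sgn≡sign (lookup (swapEntries i j v)) ⟩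
    sign (inversionParity (lookup (swapEntries i j v))) ≡⟨ cong sign (inversionParity-swap v-perm i≢j
                                                             (swapped-at i (transpose-ˡ i j)) (swapped-at j (transpose-ʳ i j))
                                                             λ m m≢i m≢j → swapped-at m (transpose-other m≢i m≢j)) ⟩
    sign (not (inversionParity (lookup v)))             ≈⟨ sign-not (inversionParity (lookup v)) ⟩
    - sign (inversionParity (lookup v))                 ≡⟨ cong -_ (sgn≡sign (lookup v)) ⟨
    - sgn F (lookup v)                                  ∎
    where
    swapped-at : ∀ m {m′} → transpose i j m ≡ m′ → lookup (swapEntries i j v) m ≡ lookup v m′
    swapped-at m τm≡m′ = ≡.trans (lookup-swapEntries i j v m) (cong (lookup v) τm≡m′)

  sgnProduct : Vec (Perm n) k → Carrier
  sgnProduct σs = prodL F (List.map (sgn F) (Vec.toList σs))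

  sgnProduct-swapSelected : ∀ {i j : Fin n} → i ≢ j → (B : Vec Bool k) {vs : Vec (Vec (Fin n) n) k} →
                            VecAll.All IsPermutation vs →
                            sgnProduct (Vec.map lookup (swapSelected i j B vs)) ≈
                            sign (isOdd (count B)) * sgnProduct (Vec.map lookup vs)
  sgnProduct-swapSelected i≢j []          VecAll.[]               = sym (*-identityˡ 1#)
  sgnProduct-swapSelected i≢j (true ∷ B) {v ∷ vs} (v-perm VecAll.∷ vs-perm) = begin
    sgn F (lookup (swapEntries _ _ v)) * sgnProduct (Vec.map lookup (swapSelected _ _ B vs))
                                   ≈⟨ *-cong (sgn-swapEntries i≢j {v} v-perm) (sgnProduct-swapSelected i≢j B vs-perm) ⟩
    - s * (q * r)                  ≈⟨ Ringₚ.-‿distribˡ-* s (q * r) ⟨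
    - (s * (q * r))                ≈⟨ -‿cong (x∙yz≈y∙xz s q r) ⟩
    - (q * (s * r))                ≈⟨ Ringₚ.-‿distribˡ-* q (s * r) ⟩
    - q * (s * r)                  ≈⟨ *-congʳ (sign-not (isOdd (count B))) ⟨
    sign (not (isOdd (count B))) * (s * r) ∎
    where
    s = sgn F (lookup v)
    q = sign (isOdd (count B))
    r = sgnProduct (Vec.map lookup vs)
  sgnProduct-swapSelected i≢j (false ∷ B) {v ∷ vs} (_ VecAll.∷ vs-perm) =
    trans (*-congˡ (sgnProduct-swapSelected i≢j B vs-perm)) (x∙yz≈y∙xz _ _ _)

  -- The property of simple tensors (of all three ranks) that makes the hyperdeterminant alternate.
  OddExchangeable : Tensor F (suc k) n → Set ℓ
  OddExchangeable {k} S = Σ (Vec Bool k) λ B → Odd (count B) ×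
    (∀ i j xs ys → S (i ∷ xs) * S (j ∷ ys) ≈ S (i ∷ merge B xs ys) * S (j ∷ merge B ys xs))

  factorization⇒oddExchangeable : ∀ {S : Tensor F (suc k) n} (B : Vec Bool k) → Odd (count B) →
    (U : Vec (Fin n) k → Carrier) (W : Fin n → Vec (Fin n) k → Carrier) →
    (∀ xs ys → U (merge B xs ys) ≈ U ys) → (∀ i xs ys → W i (merge B xs ys) ≈ W i xs) →
    (∀ i xs → S (i ∷ xs) ≈ U xs * W i xs) → OddExchangeable S
  factorization⇒oddExchangeable {S = S} B odd U W U-merge W-merge S≈UW = B , odd , λ i j xs ys → begin
    S (i ∷ xs) * S (j ∷ ys)                          ≈⟨ *-cong (S≈UW i xs) (S≈UW j ys) ⟩
    (U xs * W i xs) * (U ys * W j ys)                ≈⟨ interchange _ _ _ _ ⟩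
    (U xs * U ys) * (W i xs * W j ys)                ≈⟨ *-congʳ (*-comm _ _) ⟩
    (U ys * U xs) * (W i xs * W j ys)                ≈⟨ interchange _ _ _ _ ⟨
    (U ys * W i xs) * (U xs * W j ys)                ≈⟨ *-cong (*-cong (U-merge xs ys) (W-merge i xs ys))
                                                                (*-cong (U-merge ys xs) (W-merge j ys xs)) ⟨
    (U (merge B xs ys) * W i (merge B xs ys)) * (U (merge B ys xs) * W j (merge B ys xs))
                                                     ≈⟨ *-cong (S≈UW i _) (S≈UW j _) ⟨
    S (i ∷ merge B xs ys) * S (j ∷ merge B ys xs)    ∎

  rowDet : (Fin n → Tensor F (suc k) n) → Carrier
  rowDet {n} {k} A =
    ∑L (λ σs → sgnProduct σs * ∏L (λ m → A m (m ∷ Vec.map (λ σ → σ m) σs)) (allFin n)) (permTuples n k)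

  det≡rowDet : (T : Tensor F (suc k) n) → det F T ≡ rowDet (λ _ → T)
  det≡rowDet T = ≡.refl

  rowDet-expand : ∀ {A : Set} (ys : List A) {R : Fin n → Tensor F (suc k) n} (S : Fin n → A → Tensor F (suc k) n) →
                  (∀ m idx → R m idx ≈ ∑L (λ y → S m y idx) ys) →
                  rowDet R ≈ ∑L (λ t → rowDet (λ m → S m (lookup t m))) (tuples ys n)
  rowDet-expand {n} {k} ys {R} S R≈ = begin
    ∑L (λ σs → sgnProduct σs * ∏L (λ m → R m (factorIndex σs m)) (allFin n)) P
      ≈⟨ ∑L-cong {xs = P} (λ {σs} _ → *-congˡ (begin
           ∏L (λ m → R m (factorIndex σs m)) (allFin n)                       ≡⟨ ∏L-allFin (λ m → R m (factorIndex σs m)) ⟩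
           ∏ (λ m → R m (factorIndex σs m))                                    ≈⟨ ∏-cong (λ m → R≈ m (factorIndex σs m)) ⟩
           ∏ (λ m → ∑L (λ y → S m y (factorIndex σs m)) ys)                    ≈⟨ ∏-∑L-expand n (λ m y → S m y (factorIndex σs m)) ys ⟩
           ∑L (λ t → ∏ (λ m → S m (lookup t m) (factorIndex σs m))) (tuples ys n) ∎)) ⟩
    ∑L (λ σs → sgnProduct σs * ∑L (λ t → ∏ (λ m → S m (lookup t m) (factorIndex σs m))) (tuples ys n)) P
      ≈⟨ ∑L-cong {xs = P} (λ {σs} _ → *-distribˡ-∑L (sgnProduct σs) _ (tuples ys n)) ⟩
    ∑L (λ σs → ∑L (λ t → sgnProduct σs * ∏ (λ m → S m (lookup t m) (factorIndex σs m))) (tuples ys n)) P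
      ≈⟨ ∑L-comm _ P (tuples ys n) ⟩
    ∑L (λ t → ∑L (λ σs → sgnProduct σs * ∏ (λ m → S m (lookup t m) (factorIndex σs m))) P) (tuples ys n)
      ≈⟨ ∑L-cong {xs = tuples ys n} (λ {t} _ → ∑L-cong {xs = P} (λ {σs} _ →
           *-congˡ (reflexive (≡.sym (∏L-allFin (λ m → S m (lookup t m) (factorIndex σs m))))))) ⟩
    ∑L (λ t → rowDet (λ m → S m (lookup t m))) (tuples ys n) ∎
    where
    P = permTuples n k
    factorIndex : Vec (Perm n) k → Fin n → Vec (Fin n) (suc k)
    factorIndex σs m = m ∷ Vec.map (λ σ → σ m) σs

  rowDet-alternating : ∀ (A : Fin n → Tensor F (suc k) n) {i j} → i ≢ j → A i ≡ A j →
                       OddExchangeable (A i) → rowDet A ≈ 0#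
  rowDet-alternating {n} {k} A {i} {j} i≢j Ai≡Aj (B , odd , exchange) = begin
    rowDet A                                ≡⟨ cong (∑L term) permTuples≡ ⟩
    ∑L term (List.map (Vec.map lookup) V)   ≡⟨ ∑L-map (Vec.map lookup) V ⟩
    ∑L (term ∘ Vec.map lookup) V            ≈⟨ ∑L-cong {xs = V} (λ {vs} _ → *-congˡ (reflexive (∏-rows vs))) ⟩
    ∑L term′ V                              ≈⟨ ∑L-cancel (Vecₚ.≡-dec (Vecₚ.≡-dec _≟_)) (swapSelected i j B)
                                                 (tuples-unique (permVecs-unique n)) closed involutive moves cancels ⟩
    0#                                      ∎
    where
    V = tuples (permVecs n) k

    permTuples≡ : permTuples n k ≡ List.map (Vec.map lookup) V
    permTuples≡ = ≡.trans (permTuples≡tuples n k) (tuples-map lookup (permVecs n) k)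

    term : Vec (Perm n) k → Carrier
    term σs = sgnProduct σs * ∏L (λ m → A m (m ∷ Vec.map (λ σ → σ m) σs)) (allFin n)

    factor : Vec (Vec (Fin n) n) k → Fin n → Carrier
    factor vs m = A m (m ∷ row vs m)

    term′ : Vec (Vec (Fin n) n) k → Carrier
    term′ vs = sgnProduct (Vec.map lookup vs) * ∏ (factor vs)

    ∏-rows : ∀ vs → ∏L (λ m → A m (m ∷ Vec.map (λ σ → σ m) (Vec.map lookup vs))) (allFin n) ≡ ∏ (factor vs)
    ∏-rows vs = ≡.trans (∏L-allFin (λ m → A m (m ∷ Vec.map (λ σ → σ m) (Vec.map lookup vs))))
      (Sums.sum-cong-≗ *-commutativeMonoid λ m → cong (λ r → A m (m ∷ r)) (≡.sym (Vecₚ.map-∘ (λ σ → σ m) lookup vs)))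

    permutations : ∀ {vs} → vs ∈ V → VecAll.All IsPermutation vs
    permutations vs∈V = VecAll.map ∈permVecs⇒isPermutation (∈-tuples⁻ vs∈V)

    closed : ∀ {vs} → vs ∈ V → swapSelected i j B vs ∈ V
    closed vs∈V = ∈-tuples⁺ (swapSelected-all i j swap-∈ B (∈-tuples⁻ vs∈V))
      where
      swap-∈ : ∀ {v} → v ∈ permVecs n → swapEntries i j v ∈ permVecs n
      swap-∈ {v} v∈ = isPermutation⇒∈permVecs {w = swapEntries i j v}
        (swapEntries-isPermutation i j {v} (∈permVecs⇒isPermutation v∈))

    involutive : ∀ {vs} → vs ∈ V → swapSelected i j B (swapSelected i j B vs) ≡ vs
    involutive {vs} _ = swapSelected-involutive i j B vs

    moves : ∀ {vs} → vs ∈ V → swapSelected i j B vs ≢ vs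
    moves vs∈V fixed = contradiction (subst Odd (swapSelected-fixed i≢j B (permutations vs∈V) fixed) odd) λ ()

    exchange-ij : ∀ xs ys → A i (i ∷ xs) * A j (j ∷ ys) ≈ A i (i ∷ merge B xs ys) * A j (j ∷ merge B ys xs)
    exchange-ij = subst (λ S → ∀ xs ys → A i (i ∷ xs) * S (j ∷ ys) ≈ A i (i ∷ merge B xs ys) * S (j ∷ merge B ys xs))
                        Ai≡Aj (exchange i j)

    ∏-swapSelected : ∀ vs → ∏ (factor (swapSelected i j B vs)) ≈ ∏ (factor vs)
    ∏-swapSelected vs = ∏-cong-off₂ i≢j off (begin
      factor vs′ i * factor vs′ j
        ≡⟨ cong₂ (λ r r′ → A i (i ∷ r) * A j (j ∷ r′)) (swapped-row i (transpose-ˡ i j)) (swapped-row j (transpose-ʳ i j)) ⟩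
      A i (i ∷ merge B (row vs i) (row vs j)) * A j (j ∷ merge B (row vs j) (row vs i))
        ≈⟨ exchange-ij (row vs i) (row vs j) ⟨
      factor vs i * factor vs j ∎)
      where
      vs′ = swapSelected i j B vs
      swapped-row : ∀ m {m′} → transpose i j m ≡ m′ → row vs′ m ≡ merge B (row vs m) (row vs m′)
      swapped-row m τm≡m′ = ≡.trans (row-swapSelected i j B vs m) (cong (merge B (row vs m) ∘ row vs) τm≡m′)
      off : ∀ m → m ≢ i → m ≢ j → factor vs′ m ≈ factor vs m
      off m m≢i m≢j = reflexive (cong (λ r → A m (m ∷ r))
        (≡.trans (swapped-row m (transpose-other m≢i m≢j)) (merge-same B (row vs m))))

    cancels : ∀ {vs} → vs ∈ V → term′ vs + term′ (swapSelected i j B vs) ≈ 0#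
    cancels {vs} vs∈V = begin
      s * Π + sgnProduct (Vec.map lookup (swapSelected i j B vs)) * ∏ (factor (swapSelected i j B vs))
        ≈⟨ +-congˡ (*-cong (sgnProduct-swapSelected i≢j B (permutations vs∈V)) (∏-swapSelected vs)) ⟩
      s * Π + sign (isOdd (count B)) * s * Π  ≡⟨ cong (λ b → s * Π + sign b * s * Π) (odd⇒isOdd {count B} odd) ⟩
      s * Π + - 1# * s * Π                    ≈⟨ +-congˡ (*-congʳ (Ringₚ.-1*x≈-x s)) ⟩
      s * Π + - s * Π                         ≈⟨ +-congˡ (Ringₚ.-‿distribˡ-* s Π) ⟨
      s * Π + - (s * Π)                       ≈⟨ -‿inverseʳ (s * Π) ⟩
      0#                                      ∎
      where
      s = sgnProduct (Vec.map lookup vs)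
      Π = ∏ (factor vs)

  det-vanishes : ∀ {r} (T : Tensor F (suc k) n) (S : Fin r → Tensor F (suc k) n) → r ℕ.< n →
                 (∀ ℓ → OddExchangeable (S ℓ)) → (∀ idx → T idx ≈ ∑[ ℓ < r ] S ℓ idx) → det F T ≈ 0#
  det-vanishes {k} {n} {r} T S r<n S-odd T≈∑S = begin
    det F T                                                         ≡⟨ det≡rowDet T ⟩
    rowDet (λ _ → T)                                                ≈⟨ rowDet-expand (allFin r) (λ _ → S) (λ _ idx →
                                                                         trans (T≈∑S idx) (reflexive (≡.sym (∑L-allFin (λ ℓ → S ℓ idx))))) ⟩
    ∑L (λ t → rowDet (λ m → S (lookup t m))) (tuples (allFin r) n)  ≈⟨ ∑L-zero {xs = tuples (allFin r) n} (λ {t} _ →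
                                                                         collision t) ⟩
    0#                                                              ∎
    where
    collision : ∀ (t : Vec (Fin r) n) → rowDet (λ m → S (lookup t m)) ≈ 0#
    collision t with i , j , i<j , tᵢ≡tⱼ ← Finₚ.pigeonhole r<n (lookup t)
      = rowDet-alternating (λ m → S (lookup t m)) (Finₚ.<⇒≢ i<j) (cong S tᵢ≡tⱼ) (S-odd (lookup t i))

  sumT-lookup : ∀ {d r} (ts : Vec (Tensor F d n) r) idx → sumT F ts idx ≡ ∑[ ℓ < r ] lookup ts ℓ idx
  sumT-lookup []       idx = ≡.refl
  sumT-lookup (t ∷ ts) idx = cong (t idx +_) (sumT-lookup ts idx)

  sumT-tabulate : ∀ {d r} (f : Fin r → Tensor F d n) idx → sumT F (tabulate f) idx ≡ ∑[ ℓ < r ] f ℓ idx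
  sumT-tabulate {r = zero}  f idx = ≡.refl
  sumT-tabulate {r = suc r} f idx = cong (f zero idx +_) (sumT-tabulate (f ∘ suc) idx)

  rankLt⇒det≈0 : ∀ {P : Tensor F (suc k) n → Set (c ⊔ ℓ)} {T} → (∀ {S} → P S → OddExchangeable S) →
                 RankLt F P T n → det F T ≈ 0#
  rankLt⇒det≈0 {T = T} P⇒odd (r , r<n , ts , ts∈P , T≈) =
    det-vanishes T (lookup ts) r<n (λ ℓ → P⇒odd (VecAllₚ.lookup⁺ ts∈P ℓ))
      (λ idx → trans (T≈ idx) (reflexive (sumT-lookup ts idx)))
    where import Data.Vec.Relation.Unary.All.Properties as VecAllₚ

  oddPartOne⇒oddExchangeable : ∀ {S : Tensor F (suc k) n} → OddPartOne F S → OddExchangeable S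
  oddPartOne⇒oddExchangeable {S = S} (false ∷ A , T₁ , T₂ , _ , _ , inj₁ (odd , _) , _ , _ , S≈) =
    factorization⇒oddExchangeable {S = S} A odd (T₁ ∘ select A) (λ i xs → T₂ (i ∷ select (complement A) xs))
      (λ xs ys → reflexive (cong T₁ (select-merge A xs ys)))
      (λ i xs ys → reflexive (cong (λ w → T₂ (i ∷ w)) (select-complement-merge A xs ys)))
      (λ i xs → S≈ (i ∷ xs))
  oddPartOne⇒oddExchangeable {S = S} (true ∷ A , T₁ , T₂ , _ , _ , inj₂ (odd , _) , _ , _ , S≈) =
    factorization⇒oddExchangeable {S = S} (complement A) odd (T₂ ∘ select (complement A)) (λ i xs → T₁ (i ∷ select A xs))
      (λ xs ys → reflexive (cong T₂ (select-merge (complement A) xs ys)))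
      (λ i xs ys → reflexive (cong (λ w → T₁ (i ∷ w))
        (≡.trans (cong (select A) (merge-complement A xs ys)) (select-merge A ys xs))))
      (λ i xs → trans (S≈ (i ∷ xs)) (*-comm _ _))
  oddPartOne⇒oddExchangeable (false ∷ _ , _ , _ , _ , _ , inj₂ (_ , ()) , _)
  oddPartOne⇒oddExchangeable (true  ∷ _ , _ , _ , _ , _ , inj₁ (_ , ()) , _)

  slice⇒oddExchangeable : ∀ {S : Tensor F (suc (suc k)) n} p (v : Fin n → Carrier) (W : Tensor F (suc k) n) →
                          (∀ i xs → S (i ∷ xs) ≈ v (lookup xs p) * W (i ∷ removeAt xs p)) → OddExchangeable S
  slice⇒oddExchangeable {S = S} p v W S≈ =
    factorization⇒oddExchangeable {S = S} (singleton p) (subst Odd (≡.sym (count-singleton p)) ≡.refl)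
      (λ xs → v (lookup xs p)) (λ i xs → W (i ∷ removeAt xs p))
      (λ xs ys → reflexive (cong v (lookup-merge-singleton p xs ys)))
      (λ i xs ys → reflexive (cong (λ w → W (i ∷ w)) (removeAt-merge-singleton p xs ys)))
      S≈

  firstSlice⇒oddExchangeable : ∀ {S : Tensor F (suc k) n} → Odd k → (v : Fin n → Carrier) (W : Tensor F k n) →
                               (∀ i xs → S (i ∷ xs) ≈ v i * W xs) → OddExchangeable S
  firstSlice⇒oddExchangeable {k = k} {S = S} odd v W S≈ =
    factorization⇒oddExchangeable {S = S} (replicate k true) (subst Odd (≡.sym (count-all k)) odd) W (λ i _ → v i)
      (λ xs ys → reflexive (cong W (merge-all xs ys))) (λ _ _ _ → refl) (λ i xs → trans (S≈ i xs) (*-comm _ _))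

  sliceOne⇒oddExchangeable : ∀ {S : Tensor F (suc (suc k)) n} → Odd (suc k) → SliceOne F S → OddExchangeable S
  sliceOne⇒oddExchangeable {S = S} odd (zero , v , W , _ , S≈) = firstSlice⇒oddExchangeable {S = S} odd v W (λ i xs → S≈ (i ∷ xs))
  sliceOne⇒oddExchangeable {S = S} odd (suc p , v , W , _ , S≈) =
    slice⇒oddExchangeable {S = S} p v W λ { i (x ∷ xs) → S≈ (i ∷ x ∷ xs) }

  rankOne⇒oddExchangeable : ∀ {S : Tensor F (suc (suc k)) n} → RankOne F S → OddExchangeable S
  rankOne⇒oddExchangeable {S = S} (v₀ ∷ v₁ ∷ vs , _ , S≈) =
    slice⇒oddExchangeable {S = S} zero v₁ (λ { (i ∷ xs) → v₀ i * Vec.foldr _ _*_ 1# (tabulate λ j → lookup vs j (lookup xs j)) })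
      λ { i (x ∷ xs) → trans (S≈ (i ∷ x ∷ xs)) (x∙yz≈y∙xz _ _ _) }

  δ : Fin n → Fin n → Carrier
  δ a b = if does (a ≟ b) then 1# else 0#

  δ-refl : (a : Fin n) → δ a a ≡ 1#
  δ-refl a = cong (if_then 1# else 0#) (dec-true (a ≟ a) ≡.refl)

  δ-≢ : ∀ {a b : Fin n} → a ≢ b → δ a b ≡ 0#
  δ-≢ {a = a} {b} a≢b = cong (if_then 1# else 0#) (dec-false (a ≟ b) a≢b)

  δ-nonzero : (b : Fin n) → ¬ (∀ a → δ a b ≈ 0#)
  δ-nonzero b δ≈0 = 0≉1 (sym (trans (reflexive (≡.sym (δ-refl b))) (δ≈0 b)))

  ∑δ : ∀ (g : Fin n → Carrier) a → ∑[ b < n ] (δ a b * g b) ≈ g a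
  ∑δ g a = begin
    ∑[ b < _ ] (δ a b * g b) ≈⟨ sum-single a (λ b b≢a → trans (*-congʳ (reflexive (δ-≢ (b≢a ∘ ≡.sym)))) (zeroˡ (g b))) ⟩
    δ a a * g a              ≈⟨ *-congʳ (reflexive (δ-refl a)) ⟩
    1# * g a                 ≈⟨ *-identityˡ (g a) ⟩
    g a                      ∎

  secondSlice : Tensor F (suc (suc k)) n → Fin n → Tensor F (suc (suc k)) n
  secondSlice T m (i ∷ x ∷ xs) = δ x m * T (i ∷ m ∷ xs)

  ∑secondSlice : ∀ (T : Tensor F (suc (suc k)) n) idx → T idx ≈ ∑[ m < n ] secondSlice T m idx
  ∑secondSlice T (i ∷ x ∷ xs) = sym (∑δ (λ m → T (i ∷ m ∷ xs)) x)

  secondSlice-oddExchangeable : ∀ (T : Tensor F (suc (suc k)) n) m → OddExchangeable (secondSlice T m)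
  secondSlice-oddExchangeable T m = slice⇒oddExchangeable {S = secondSlice T m} zero (λ x → δ x m)
    (λ { (i ∷ xs) → T (i ∷ m ∷ xs) }) λ { i (x ∷ xs) → refl }

  -- The other n - 1 slices are fewer than n odd-exchangeable tensors.
  secondSlice-vanishes⇒det≈0 : ∀ (T : Tensor F (suc (suc k)) n) m → (∀ i xs → T (i ∷ m ∷ xs) ≈ 0#) → det F T ≈ 0#
  secondSlice-vanishes⇒det≈0 {n = suc n} T m slice≈0 =
    det-vanishes T (secondSlice T ∘ punchIn m) ℕₚ.≤-refl (secondSlice-oddExchangeable T ∘ punchIn m) λ idx → begin
      T idx                                                       ≈⟨ ∑secondSlice T idx ⟩
      ∑[ b < suc n ] secondSlice T b idx                          ≈⟨ sum-remove {i = m} (λ b → secondSlice T b idx) ⟩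
      secondSlice T m idx + ∑[ ℓ < n ] secondSlice T (punchIn m ℓ) idx ≈⟨ +-congʳ (vanishes idx) ⟩
      0# + ∑[ ℓ < n ] secondSlice T (punchIn m ℓ) idx             ≈⟨ +-identityˡ _ ⟩
      ∑[ ℓ < n ] secondSlice T (punchIn m ℓ) idx                  ∎
    where
    vanishes : ∀ idx → secondSlice T m idx ≈ 0#
    vanishes (i ∷ x ∷ xs) = trans (*-congˡ (slice≈0 i xs)) (zeroʳ _)

  secondSlice-decomposition : ∀ {P : Tensor F (suc (suc k)) n → Set (c ⊔ ℓ)} (T : Tensor F (suc (suc k)) n) →
                              (∀ m → P (secondSlice T m)) → HasDecomp F P T n
  secondSlice-decomposition T P-slice = tabulate (secondSlice T) , VecAllₚ.tabulate⁺ P-slice ,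
    λ idx → trans (∑secondSlice T idx) (reflexive (≡.sym (sumT-tabulate (secondSlice T) idx)))
    where import Data.Vec.Relation.Unary.All.Properties as VecAllₚ

  secondSlice-sliceOne : ∀ (T : Tensor F (suc (suc k)) n) m → SliceOne F (secondSlice T m)
  secondSlice-sliceOne T m = suc zero , (λ x → δ x m) , (λ { (i ∷ xs) → T (i ∷ m ∷ xs) }) , δ-nonzero m ,
    λ { (i ∷ x ∷ xs) → refl }

  -- The blocks are {1, 3, …, d} (containing the first index) and the odd block {2}.
  secondSlice-oddPartOne : ∀ (T : Tensor F (suc (suc k)) n) → ¬ (det F T ≈ 0#) → ∀ m → OddPartOne F (secondSlice T m)
  secondSlice-oddPartOne {k = k} {n = n} T det≉0 m =
    true ∷ false ∷ replicate k true , T₁ , T₂ , s≤s z≤n , s≤s z≤n ,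
    inj₂ (subst (Odd ∘ suc) (≡.sym (count-complement-all k)) ≡.refl , ≡.refl) ,
    (λ T₁≈0 → det≉0 (secondSlice-vanishes⇒det≈0 T m λ i xs →
       trans (reflexive (cong (λ w → T (i ∷ m ∷ w)) (≡.sym (unselectAll-select xs)))) (T₁≈0 (i ∷ select (replicate k true) xs)))) ,
    (λ T₂≈0 → δ-nonzero m (λ x → T₂≈0 (x ∷ replicate _ m))) ,
    λ { (i ∷ x ∷ xs) → trans (*-comm _ _) (*-congʳ (reflexive (cong (λ w → T (i ∷ m ∷ w)) (≡.sym (unselectAll-select xs))))) }
    where
    T₁ : Tensor F (suc (count (replicate k true))) n
    T₁ (i ∷ w) = T (i ∷ m ∷ unselectAll k w)
    T₂ : Tensor F (suc (count (complement (replicate k true)))) n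
    T₂ (x ∷ _) = δ x m

theorem4p3 : ∀ {c ℓ} (F : Field c ℓ) (d n : ℕ) → 2 ≤ d → 1 ≤ n →
             (T : Tensor F d n) →
             (RankLt F (OddPartOne F) T n → Field._≈_ F (det F T) (Field.0# F)) ×
             (¬ Field._≈_ F (det F T) (Field.0# F) →
                RankEq F (OddPartOne F) T n ×
                RankGe F (RankOne F) T n ×
                (Even d → RankEq F (SliceOne F) T n))
theorem4p3 F (suc (suc k)) n (s≤s (s≤s z≤n)) _ T = oprank<n⇒det≈0 , λ det≉0 →
    (secondSlice-decomposition T (secondSlice-oddPartOne T det≉0) , det≉0 ∘ oprank<n⇒det≈0)
  , det≉0 ∘ rankLt⇒det≈0 rankOne⇒oddExchangeable
  , λ even → secondSlice-decomposition T (secondSlice-sliceOne T)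
           , det≉0 ∘ rankLt⇒det≈0 (sliceOne⇒oddExchangeable (InversionParity.even⇒odd-pred (suc k) even))
  where
  open Hyperdeterminant F
  oprank<n⇒det≈0 : RankLt F (OddPartOne F) T n → Field._≈_ F (det F T) (Field.0# F)
  oprank<n⇒det≈0 = rankLt⇒det≈0 oddPartOne⇒oddExchangeable
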